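{- Let $G$ be a finite tree with at least two vertices. Then $D_3(G)$ is connected if and only if $G$ has two inner nodes whose distance is $3k+1$ or $3k+2$ for some integer $k\geqslant 0$.
   Context: The $3$-distance graph $D_3(G)$ has vertex set $V(G)$, two vertices being adjacent iff their distance in $G$ is exactly $3$. A vertex $u$ of a graph $G$ is an inner node if $\deg(u)\geqslant 3$ and $u$ has at least two neighbours of degree at least $2$. -}

module Defs where

open import Data.Nat using (ℕ; zero; suc; _≤_; _+_)
open import Data.Fin using (Fin)
open import Data.Bool using (Bool; T)
open import Data.Empty using (⊥)
open import Data.List using (List; []; _∷_; length; filterᵇ; allFin)
open import Data.List.Relation.Unary.Unique.Propositional using (Unique)
open import Data.Product using (Σ; _×_; ∃; ∃-syntax)
open import Relation.Binary.PropositionalEquality using (_≡_)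
open import Relation.Nullary using (¬_)
open import Relation.Binary.Construct.Closure.ReflexiveTransitive using (Star)

record Graph (n : ℕ) : Set where
  field
    adj    : Fin n → Fin n → Bool
    sym    : ∀ u v → adj u v ≡ adj v u
    irrefl : ∀ u → ¬ T (adj u u)

open Graph public

Adj : ∀ {n} → Graph n → Fin n → Fin n → Set
Adj G u v = T (adj G u v)

deg : ∀ {n} → Graph n → Fin n → ℕ
deg G u = length (filterᵇ (adj G u) (allFin _))

data Walk {n} (G : Graph n) : Fin n → Fin n → ℕ → Set where
  here  : ∀ {u} → Walk G u u 0
  there : ∀ {u v w k} → Adj G u v → Walk G v w k → Walk G u w (suc k)

Dist : ∀ {n} → Graph n → Fin n → Fin n → ℕ → Set
Dist G u v d = Walk G u v d × (∀ m → Walk G u v m → d ≤ m)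

ConnectedRel : ∀ {n} → (Fin n → Fin n → Set) → Set
ConnectedRel {n} R = ∀ (u v : Fin n) → Star R u v

Connected : ∀ {n} → Graph n → Set
Connected G = ConnectedRel (Adj G)

data Chain {n} (G : Graph n) : List (Fin n) → Set where
  nil  : Chain G []
  one  : ∀ {u} → Chain G (u ∷ [])
  cons : ∀ {u v vs} → Adj G u v → Chain G (v ∷ vs) → Chain G (u ∷ v ∷ vs)

data Last {A : Set} : List A → A → Set where
  last-one  : ∀ {x} → Last (x ∷ []) x
  last-cons : ∀ {x y ys z} → Last (y ∷ ys) z → Last (x ∷ y ∷ ys) z

IsCycle : ∀ {n} → Graph n → List (Fin n) → Set
IsCycle G [] = ⊥
IsCycle G (v ∷ vs) =
  3 ≤ length (v ∷ vs) × Unique (v ∷ vs) × Chain G (v ∷ vs)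
  × Σ (Fin _) (λ w → Last (v ∷ vs) w × Adj G w v)

Acyclic : ∀ {n} → Graph n → Set
Acyclic G = ∀ cs → ¬ IsCycle G cs

IsTree : ∀ {n} → Graph n → Set
IsTree G = Connected G × Acyclic G

D3Adj : ∀ {n} → Graph n → Fin n → Fin n → Set
D3Adj G u v = Dist G u v 3

D3Connected : ∀ {n} → Graph n → Set
D3Connected G = ConnectedRel (D3Adj G)

InnerNode : ∀ {n} → Graph n → Fin n → Set
InnerNode G u =
  3 ≤ deg G u ×
  ∃[ v ] ∃[ w ] (¬ v ≡ w × Adj G u v × Adj G u w × 2 ≤ deg G v × 2 ≤ deg G w)

module Submission where

-- Along a geodesic, three steps at a time are a D₃-edge, so every vertex at distance
-- ≡ 0 (mod 3) from p is D₃-reachable from p. Any two neighbours of an inner node p are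
-- at distance 3 from a common vertex (a further neighbour of a neighbour of degree ≥ 2),
-- hence all of them lie in one D₃-component, which also contains every vertex at
-- distance ≢ 0 (mod 3) from p. Two inner nodes at distance ≢ 0 (mod 3) merge these
-- components into one.
-- Conversely, root the tree at a vertex r of degree ≥ 2: the distance to r changes by
-- exactly 1 along every edge. A D₃-path from r to a neighbour of r must contain a
-- D₃-edge whose endpoints have different residues of that distance; the three tree
-- edges under it cannot climb straight or form a peak, so they form a valley whose
-- bottom is an inner node at distance ≢ 0 (mod 3) from r. Doing this from a vertex of
-- degree ≥ 2, and again from the inner node found, gives the two inner nodes.

open import Defs hiding (sym)
open import Data.Nat using (ℕ; zero; suc; _≤_; _<_; _+_; _*_; _%_; NonZero; z≤n; s≤s; s≤s⁻¹; z<s)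
open import Data.Nat.Properties
open import Data.Nat.DivMod using (%-remove-+ˡ; %-remove-+ʳ)
open import Data.Nat.Divisibility using (m∣m*n; m%n≡0⇒n∣m)
open import Data.Nat.Induction using (<-rec)
open import Data.Fin using (Fin; zero; suc) renaming (_≟_ to _≟ᶠ_)
open import Data.Fin.Properties using (any?)
open import Data.Bool using (T)
open import Data.Bool.Properties using (T?)
open import Data.Product using (_×_; _,_; proj₁; proj₂; ∃; ∃₂; ∃-syntax)
open import Data.Sum using (_⊎_; inj₁; inj₂)
open import Data.Empty using (⊥; ⊥-elim)
open import Function using (_∘_)
open import Function.Bundles using (_⇔_; mk⇔)
open import Relation.Nullary using (¬_; Dec; yes; no; ¬?; contradiction)
open import Relation.Nullary.Decidable using (map′; _×-dec_; decidable-stable)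
open import Relation.Binary.Definitions using (DecidableEquality; tri<; tri≈; tri>)
open import Relation.Binary.PropositionalEquality
open import Relation.Binary.Construct.Closure.ReflexiveTransitive using (Star; ε; _◅_; _◅◅_; reverse)
open import Data.List using (List; []; _∷_; _∷ʳ_; length; filter; filterᵇ; allFin)
open import Data.List.Properties using (filter-notAll)
open import Data.List.Membership.Propositional using (_∈_; find; lose)
open import Data.List.Membership.Propositional.Properties using (∈-allFin; ∈-filter⁺; ∈-filter⁻; ∈-length; ∈-++⁺ʳ)
import Data.List.Membership.DecPropositional as DecMembership
open import Data.List.Relation.Binary.Subset.Propositional using (_⊆_)
open import Data.List.Relation.Unary.All as All using (All; []; _∷_)
open import Data.List.Relation.Unary.All.Properties using (¬Any⇒All¬; ++⁺)
import Data.List.Relation.Unary.Any as Any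
open import Data.List.Relation.Unary.AllPairs using ([]; _∷_)
open import Data.List.Relation.Unary.Unique.Propositional using (Unique)
open import Data.List.Relation.Unary.Unique.Propositional.Properties using (allFin⁺; filter⁺)

%≡0-cancelʳ-+ : ∀ m n d .{{_ : NonZero d}} → (m + n) % d ≡ 0 → n % d ≡ 0 → m % d ≡ 0
%≡0-cancelʳ-+ m n d m+n≡0 n≡0 = trans (sym (%-remove-+ʳ m (m%n≡0⇒n∣m n d n≡0))) m+n≡0

≡3k+1⊎≡3k+2⇒%3≢0 : ∀ {d} k → d ≡ 3 * k + 1 ⊎ d ≡ 3 * k + 2 → d % 3 ≢ 0
≡3k+1⊎≡3k+2⇒%3≢0 k (inj₁ refl) d≡0 =
  contradiction (trans (sym (%-remove-+ˡ {3 * k} 1 (m∣m*n k))) d≡0) λ ()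
≡3k+1⊎≡3k+2⇒%3≢0 k (inj₂ refl) d≡0 =
  contradiction (trans (sym (%-remove-+ˡ {3 * k} 2 (m∣m*n k))) d≡0) λ ()

-- (3 + d) % 3 reduces to d % 3 definitionally, here and throughout.
%3≢0⇒≡3k+1⊎≡3k+2 : ∀ d → d % 3 ≢ 0 → ∃ λ k → d ≡ 3 * k + 1 ⊎ d ≡ 3 * k + 2
%3≢0⇒≡3k+1⊎≡3k+2 zero d≢0 = contradiction refl d≢0
%3≢0⇒≡3k+1⊎≡3k+2 (suc zero) _ = 0 , inj₁ refl
%3≢0⇒≡3k+1⊎≡3k+2 (suc (suc zero)) _ = 0 , inj₂ refl
%3≢0⇒≡3k+1⊎≡3k+2 (suc (suc (suc d))) d≢0 with %3≢0⇒≡3k+1⊎≡3k+2 d d≢0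
... | k , inj₁ refl = suc k , inj₁ (cong (_+ 1) (sym (*-suc 3 k)))
... | k , inj₂ refl = suc k , inj₂ (cong (_+ 2) (sym (*-suc 3 k)))

module _ {A : Set} (_≟_ : DecidableEquality A) where

  Unique-⊆⇒length≤ : ∀ {xs ys : List A} → Unique xs → xs ⊆ ys → length xs ≤ length ys
  Unique-⊆⇒length≤ {[]} _ _ = z≤n
  Unique-⊆⇒length≤ {x ∷ xs} {ys} (x∉xs ∷ xs!) x∷xs⊆ys =
    ≤-trans (s≤s (Unique-⊆⇒length≤ xs! xs⊆ys-x)) (filter-notAll ≢x? ys x∈ys)
    where
    ≢x? : ∀ y → Dec (y ≢ x)
    ≢x? y = ¬? (y ≟ x)

    xs⊆ys-x : xs ⊆ filter ≢x? ys
    xs⊆ys-x y∈xs = ∈-filter⁺ ≢x? (x∷xs⊆ys (Any.there y∈xs)) λ y≡x → All.lookup x∉xs y∈xs (sym y≡x)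

    x∈ys : Any.Any (λ y → ¬ y ≢ x) ys
    x∈ys = Any.map (λ x≡y y≢x → y≢x (sym x≡y)) (x∷xs⊆ys (Any.here refl))

Unique-∷ʳ : ∀ {A : Set} {xs : List A} {b} → Unique xs → All (b ≢_) xs → Unique (xs ∷ʳ b)
Unique-∷ʳ [] [] = [] ∷ []
Unique-∷ʳ (x∉xs ∷ xs!) (b≢x ∷ b∉xs) = ++⁺ x∉xs (≢-sym b≢x ∷ []) ∷ Unique-∷ʳ xs! b∉xs

Last-∷ʳ : ∀ {A : Set} (xs : List A) b → Last (xs ∷ʳ b) b
Last-∷ʳ [] b = last-one
Last-∷ʳ (x ∷ []) b = last-cons last-one
Last-∷ʳ (x ∷ y ∷ xs) b = last-cons (Last-∷ʳ (y ∷ xs) b)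

Chain-∷ʳ : ∀ {n} {G : Graph n} {xs z b} → Chain G xs → Last xs z → Adj G z b → Chain G (xs ∷ʳ b)
Chain-∷ʳ one last-one z-b = cons z-b one
Chain-∷ʳ (cons x-y chain) (last-cons last) z-b = cons x-y (Chain-∷ʳ chain last z-b)

module Neighbourhood {n : ℕ} (G : Graph n) where
  open DecMembership (_≟ᶠ_ {n}) using (_∈?_)

  Adj-sym : ∀ {u v} → Adj G u v → Adj G v u
  Adj-sym {u} {v} = subst T (Graph.sym G u v)

  Adj⇒≢ : ∀ {u v} → Adj G u v → u ≢ v
  Adj⇒≢ {u} u-u refl = irrefl G u u-u

  neighbours : Fin n → List (Fin n)
  neighbours u = filterᵇ (adj G u) (allFin n)

  ∈-neighbours⁺ : ∀ {u v} → Adj G u v → v ∈ neighbours u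
  ∈-neighbours⁺ {u} {v} = ∈-filter⁺ (T? ∘ adj G u) (∈-allFin v)

  ∈-neighbours⁻ : ∀ {u v} → v ∈ neighbours u → Adj G u v
  ∈-neighbours⁻ {u} = proj₂ ∘ ∈-filter⁻ (T? ∘ adj G u) {xs = allFin n}

  neighbours-Unique : ∀ u → Unique (neighbours u)
  neighbours-Unique u = filter⁺ (T? ∘ adj G u) (allFin⁺ n)

  Unique-neighbours⇒length≤deg : ∀ {u vs} → Unique vs → All (Adj G u) vs → length vs ≤ deg G u
  Unique-neighbours⇒length≤deg vs! u-vs =
    Unique-⊆⇒length≤ _≟ᶠ_ vs! (All.lookup (All.map ∈-neighbours⁺ u-vs))

  two-neighbours⇒deg≥2 : ∀ {u a b} → Adj G u a → Adj G u b → a ≢ b → 2 ≤ deg G u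
  two-neighbours⇒deg≥2 u-a u-b a≢b =
    Unique-neighbours⇒length≤deg ((a≢b ∷ []) ∷ [] ∷ []) (u-a ∷ u-b ∷ [])

  neighbour-avoiding : ∀ {u} vs → length vs < deg G u → ∃ λ c → Adj G u c × All (c ≢_) vs
  neighbour-avoiding {u} vs vs<deg with Any.any? (λ c → ¬? (c ∈? vs)) (neighbours u)
  ... | yes some = let c , c∈N , c∉vs = find some in c , ∈-neighbours⁻ c∈N , ¬Any⇒All¬ vs c∉vs
  ... | no none = contradiction (Unique-⊆⇒length≤ _≟ᶠ_ (neighbours-Unique u) N⊆vs) (<⇒≱ vs<deg)
    where
    N⊆vs : neighbours u ⊆ vs
    N⊆vs {c} c∈N = decidable-stable (c ∈? vs) λ c∉vs → none (lose c∈N c∉vs)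

module Walks {n : ℕ} (G : Graph n) where
  open Neighbourhood G

  _++ʷ_ : ∀ {u v w a b} → Walk G u v a → Walk G v w b → Walk G u w (a + b)
  here ++ʷ q = q
  there e p ++ʷ q = there e (p ++ʷ q)

  _∷ʳʷ_ : ∀ {u v w a} → Walk G u v a → Adj G v w → Walk G u w (suc a)
  here ∷ʳʷ e = there e here
  there e p ∷ʳʷ e′ = there e (p ∷ʳʷ e′)

  reverseʷ : ∀ {u v a} → Walk G u v a → Walk G v u a
  reverseʷ here = here
  reverseʷ (there e p) = reverseʷ p ∷ʳʷ Adj-sym e

  Walk0⇒≡ : ∀ {u v} → Walk G u v 0 → u ≡ v
  Walk0⇒≡ here = refl

  Star⇒Walk : ∀ {u v} → Star (Adj G) u v → ∃ (Walk G u v)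
  Star⇒Walk ε = 0 , here
  Star⇒Walk (e ◅ es) = let k , p = Star⇒Walk es in suc k , there e p

  walk? : ∀ m u v → Dec (Walk G u v m)
  walk? zero u v = map′ (λ { refl → here }) Walk0⇒≡ (u ≟ᶠ v)
  walk? (suc m) u v =
    map′ (λ (w , e , p) → there e p) (λ { (there {v = w} e p) → w , e , p })
      (any? λ w → T? (adj G u w) ×-dec walk? m w v)

  Walk⇒Dist : ∀ {u v} k → Walk G u v k → ∃ (Dist G u v)
  Walk⇒Dist {u} {v} = <-rec (λ k → Walk G u v k → ∃ (Dist G u v)) shorten
    where
    shorten : ∀ k → (∀ {m} → m < k → Walk G u v m → ∃ (Dist G u v)) → Walk G u v k → ∃ (Dist G u v)
    shorten k rec p with anyUpTo? (λ m → walk? m u v) k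
    ... | yes (m , m<k , q) = rec m<k q
    ... | no no-shorter = k , p , λ m q → ≮⇒≥ λ m<k → no-shorter (m , m<k , q)

  Dist-unique : ∀ {u v a b} → Dist G u v a → Dist G u v b → a ≡ b
  Dist-unique (p , p-min) (q , q-min) = ≤-antisym (p-min _ q) (q-min _ p)

  Dist-sym : ∀ {u v d} → Dist G u v d → Dist G v u d
  Dist-sym (p , p-min) = reverseʷ p , λ m q → p-min m (reverseʷ q)

  Dist-refl : ∀ {u} → Dist G u u 0
  Dist-refl = here , λ _ _ → z≤n

  Dist0⇒≡ : ∀ {u v} → Dist G u v 0 → u ≡ v
  Dist0⇒≡ = Walk0⇒≡ ∘ proj₁

  Dist1⇒Adj : ∀ {u v} → Dist G u v 1 → Adj G u v
  Dist1⇒Adj (there e here , _) = e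

  Adj⇒Dist1 : ∀ {u v} → Adj G u v → Dist G u v 1
  Adj⇒Dist1 u-v = there u-v here , λ
    { zero p → contradiction (Walk0⇒≡ p) (Adj⇒≢ u-v)
    ; (suc m) _ → s≤s z≤n }

  Dist-step : ∀ {u r k} → Dist G u r (suc k) → ∃ λ w → Adj G u w × Dist G w r k
  Dist-step (there {v = w} e p , p-min) = w , e , p , λ m q → s≤s⁻¹ (p-min (suc m) (there e q))

  Dist-adj-≤ : ∀ {x y r a b} → Adj G x y → Dist G x r a → Dist G y r b → b ≤ suc a
  Dist-adj-≤ x-y (p , _) (_ , q-min) = q-min _ (there (Adj-sym x-y) p)

  Dist-prefix : ∀ {x y r k e} → Walk G x y k → Dist G y r e → Dist G x r (k + e) → Dist G x y k
  Dist-prefix {k = k} {e} p (q , _) (_ , min) = p , λ m p′ → +-cancelʳ-≤ e k m (min (m + e) (p′ ++ʷ q))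

  Dist-split : ∀ k {x r e} → Dist G x r (k + e) → ∃ λ y → Dist G x y k × Dist G y r e
  Dist-split zero dx = _ , Dist-refl , dx
  Dist-split (suc k) dx with Dist-step dx
  ... | w , x-w , dw with Dist-split k dw
  ...   | y , (p , _) , dy = y , Dist-prefix (there x-w p) dy dx , dy

  D3Adj⇒path : ∀ {y w} → D3Adj G y w →
    ∃₂ λ m₁ m₂ → Adj G y m₁ × Adj G m₁ m₂ × Adj G m₂ w × y ≢ m₂ × m₁ ≢ w
  D3Adj⇒path (there {v = m₁} y-m₁ (there {v = m₂} m₁-m₂ (there m₂-w here)) , min) =
    m₁ , m₂ , y-m₁ , m₁-m₂ , m₂-w ,
    (λ { refl → 3≰1 (min 1 (there m₂-w here)) }) , (λ { refl → 3≰1 (min 1 (there y-m₁ here)) })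
    where
    3≰1 : ¬ 3 ≤ 1
    3≰1 (s≤s ())

  _≈₃_ : Fin n → Fin n → Set
  x ≈₃ y = Star (D3Adj G) x y

  ≈₃-sym : ∀ {x y} → x ≈₃ y → y ≈₃ x
  ≈₃-sym = reverse Dist-sym

  D3-reach-multiple : ∀ e {x r} → Dist G x r e → e % 3 ≡ 0 → x ≈₃ r
  D3-reach-multiple zero dx _ rewrite Dist0⇒≡ dx = ε
  D3-reach-multiple (suc zero) _ ()
  D3-reach-multiple (suc (suc zero)) _ ()
  D3-reach-multiple (suc (suc (suc e))) dx e≡0 with Dist-split 3 dx
  ... | y , x~y , dy = x~y ◅ D3-reach-multiple e dy e≡0

module Levels {n : ℕ} (G : Graph n) (acyclic : Acyclic G) (r : Fin n) where
  open Neighbourhood G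
  open Walks G

  AtMost : ℕ → Fin n → Set
  AtMost k z = ∃ λ j → j ≤ k × Dist G z r j

  level-<⇒≢ : ∀ {a b d e} → Dist G a r d → Dist G b r e → d < e → a ≢ b
  level-<⇒≢ da db d<e refl = <⇒≢ d<e (Dist-unique da db)

  AtMost-suc : ∀ {k z} → AtMost k z → AtMost (suc k) z
  AtMost-suc (j , j≤k , dz) = j , m≤n⇒m≤1+n j≤k , dz

  above-∉ : ∀ {z e k vs} → Dist G z r e → k < e → All (AtMost k) vs → All (z ≢_) vs
  above-∉ dz k<e = All.map λ (j , j≤k , dy) → ≢-sym (level-<⇒≢ dy dz (≤-<-trans j≤k k<e))

  -- A simple path from a towards r and back up to b; one more edge closing it is a cycle.
  record LowPath (k : ℕ) (a b : Fin n) : Set where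
    field
      tail   : List (Fin n)
      chain  : Chain G (a ∷ tail)
      unique : Unique (a ∷ tail)
      last   : Last (a ∷ tail) b
      long   : 2 ≤ length tail
      low    : All (AtMost k) (a ∷ tail)

  lowPath : ∀ k {a b} → a ≢ b → Dist G a r k → Dist G b r k → LowPath k a b
  lowPath zero a≢b da db = contradiction (trans (Dist0⇒≡ da) (sym (Dist0⇒≡ db))) a≢b
  lowPath (suc k) {a} {b} a≢b da db with Dist-step da | Dist-step db
  ... | a₁ , a-a₁ , da₁ | b₁ , b-b₁ , db₁ with a₁ ≟ᶠ b₁
  ... | yes refl = record
    { tail   = a₁ ∷ b ∷ []
    ; chain  = cons a-a₁ (cons (Adj-sym b-b₁) one)
    ; unique = (≢-sym (level-<⇒≢ da₁ da ≤-refl) ∷ a≢b ∷ []) ∷ (level-<⇒≢ da₁ db ≤-refl ∷ []) ∷ [] ∷ []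
    ; last   = last-cons (last-cons last-one)
    ; long   = s≤s (s≤s z≤n)
    ; low    = (suc k , ≤-refl , da) ∷ (k , n≤1+n k , da₁) ∷ (suc k , ≤-refl , db) ∷ []
    }
  ... | no a₁≢b₁ = record
    { tail   = (a₁ ∷ tail) ∷ʳ b
    ; chain  = cons a-a₁ (Chain-∷ʳ chain last (Adj-sym b-b₁))
    ; unique = ++⁺ (above-∉ da ≤-refl low) (a≢b ∷ []) ∷ Unique-∷ʳ unique (above-∉ db ≤-refl low)
    ; last   = last-cons (Last-∷ʳ (a₁ ∷ tail) b)
    ; long   = s≤s (∈-length (∈-++⁺ʳ tail (Any.here refl)))
    ; low    = (suc k , ≤-refl , da) ∷ ++⁺ (All.map AtMost-suc low) ((suc k , ≤-refl , db) ∷ [])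
    }
    where open LowPath (lowPath k a₁≢b₁ da₁ db₁)

  ¬level-edge : ∀ {x y k} → Adj G x y → Dist G x r k → Dist G y r k → ⊥
  ¬level-edge {x} {y} {k} x-y dx dy =
    acyclic (x ∷ tail) (s≤s long , unique , chain , y , last , Adj-sym x-y)
    where open LowPath (lowPath k (Adj⇒≢ x-y) dx dy)

  ¬two-parents : ∀ {x a b k} → Dist G x r (suc k) → Adj G x a → Adj G x b → a ≢ b →
    Dist G a r k → Dist G b r k → ⊥
  ¬two-parents {x} {a} {b} {k} dx x-a x-b a≢b da db =
    acyclic (x ∷ a ∷ tail)
      ( s≤s (s≤s (≤-trans (n≤1+n 1) long)) , above-∉ dx ≤-refl low ∷ unique , cons x-a chain
      , b , last-cons last , Adj-sym x-b )
    where open LowPath (lowPath k a≢b da db)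

  adjacent-levels : ∀ {x y a b} → Adj G x y → Dist G x r a → Dist G y r b → b ≡ suc a ⊎ a ≡ suc b
  adjacent-levels {a = a} {b} x-y dx dy with <-cmp a b
  ... | tri< a<b _ _ = inj₁ (≤-antisym (Dist-adj-≤ x-y dx dy) a<b)
  ... | tri≈ _ refl _ = ⊥-elim (¬level-edge x-y dx dy)
  ... | tri> _ _ b<a = inj₂ (≤-antisym (Dist-adj-≤ (Adj-sym x-y) dy dx) b<a)

module Tree {n : ℕ} (G : Graph n) (connected : Connected G) (acyclic : Acyclic G) where
  open Neighbourhood G
  open Walks G
  open Levels G acyclic

  distance : ∀ u v → ∃ (Dist G u v)
  distance u v = let k , p = Star⇒Walk (connected u v) in Walk⇒Dist k p

  away-from-root : ∀ {r y z x k} → Dist G y r (suc k) → Adj G y z → Dist G z r k →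
    Adj G y x → x ≢ z → Dist G x r (suc (suc k))
  away-from-root {r} {x = x} dy y-z dz y-x x≢z with distance x r
  ... | _ , dx with adjacent-levels r y-x dy dx
  ...   | inj₁ refl = dx
  ...   | inj₂ refl = ⊥-elim (¬two-parents r dy y-x y-z x≢z dx dz)

  nonbacktracking⇒D3Adj : ∀ {a b c d} → Adj G a b → Adj G b c → Adj G c d → a ≢ c → b ≢ d →
    D3Adj G a d
  nonbacktracking⇒D3Adj {a} {b} {c} {d} a-b b-c c-d a≢c b≢d = Dist-sym d-at-3
    where
    b-at-1 : Dist G b a 1
    b-at-1 = Adj⇒Dist1 (Adj-sym a-b)

    c-at-2 : Dist G c a 2
    c-at-2 = away-from-root b-at-1 (Adj-sym a-b) Dist-refl b-c (≢-sym a≢c)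

    d-at-3 : Dist G d a 3
    d-at-3 = away-from-root c-at-2 (Adj-sym b-c) b-at-1 c-d (≢-sym b≢d)

  linked-through : ∀ {p x z b} → Adj G p x → Adj G p z → Adj G p b → b ≢ x → b ≢ z → 2 ≤ deg G b →
    x ≈₃ z
  linked-through {p} {b = b} p-x p-z p-b b≢x b≢z deg-b with neighbour-avoiding (p ∷ []) deg-b
  ... | c , b-c , c≢p ∷ [] = Dist-sym (c~ p-x b≢x) ◅ c~ p-z b≢z ◅ ε
    where
    c~ : ∀ {y} → Adj G p y → b ≢ y → D3Adj G c y
    c~ p-y b≢y = nonbacktracking⇒D3Adj (Adj-sym b-c) (Adj-sym p-b) p-y c≢p b≢y

  inner-neighbours-linked : ∀ {p s t} → InnerNode G p → Adj G p s → Adj G p t → s ≈₃ t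
  inner-neighbours-linked {p} (deg-p , v , w , v≢w , p-v , p-w , deg-v , deg-w) p-s p-t =
    to-v p-s ◅◅ ≈₃-sym (to-v p-t)
    where
    to-v : ∀ {s} → Adj G p s → s ≈₃ v
    to-v {s} p-s with s ≟ᶠ v | s ≟ᶠ w
    ... | yes refl | _ = ε
    ... | no _ | no s≢w = linked-through p-s p-v p-w (≢-sym s≢w) (≢-sym v≢w) deg-w
    ... | no _ | yes refl with neighbour-avoiding (v ∷ w ∷ []) deg-p
    ...   | c , p-c , c≢v ∷ c≢w ∷ [] =
      linked-through p-w p-c p-v v≢w (≢-sym c≢v) deg-v ◅◅
      linked-through p-c p-v p-w (≢-sym c≢w) (≢-sym v≢w) deg-w

  D3-reach-nonmultiple : ∀ {p s} → InnerNode G p → Adj G p s → ∀ e {x} → Dist G x p e → e % 3 ≢ 0 →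
    x ≈₃ s
  D3-reach-nonmultiple _ _ zero _ e≢0 = contradiction refl e≢0
  D3-reach-nonmultiple inner p-s (suc zero) dx _ =
    inner-neighbours-linked inner (Adj-sym (Dist1⇒Adj dx)) p-s
  D3-reach-nonmultiple {p} inner@(deg-p , _) p-s (suc (suc zero)) {x} dx _ with Dist-step dx
  ... | m , x-m , dm with neighbour-avoiding (m ∷ []) (≤-trans (n≤1+n 2) deg-p)
  ...   | c , p-c , c≢m ∷ [] =
    nonbacktracking⇒D3Adj x-m (Dist1⇒Adj dm) p-c x≢p (≢-sym c≢m) ◅ inner-neighbours-linked inner p-c p-s
    where
    x≢p : x ≢ p
    x≢p refl = contradiction (Dist-unique dx Dist-refl) λ ()
  D3-reach-nonmultiple inner p-s (suc (suc (suc e))) dx e≢0 with Dist-split 3 dx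
  ... | y , x~y , dy = x~y ◅ D3-reach-nonmultiple inner p-s e dy e≢0

  neighbour-off-multiple : ∀ {p q d} → 2 ≤ deg G q → Dist G q p (suc d) →
    ∃ λ z → Adj G q z × ∃ λ e → Dist G z p e × e % 3 ≢ 0
  neighbour-off-multiple {d = d} deg-q dq with Dist-step dq
  ... | z₀ , q-z₀ , dz₀ with d % 3 ≟ 0
  ...   | no d≢0 = z₀ , q-z₀ , d , dz₀ , d≢0
  ...   | yes d≡0 with neighbour-avoiding (z₀ ∷ []) deg-q
  ...     | z , q-z , z≢z₀ ∷ [] =
    z , q-z , suc (suc d) , away-from-root dq q-z₀ dz₀ q-z z≢z₀ ,
    λ 2+d≡0 → contradiction (%≡0-cancelʳ-+ 2 d 3 2+d≡0 d≡0) λ ()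

  inner-pair⇒D3Connected : ∀ {p q d} → InnerNode G p → InnerNode G q → Dist G p q d → d % 3 ≢ 0 →
    D3Connected G
  inner-pair⇒D3Connected {d = zero} _ _ _ d≢0 = contradiction refl d≢0
  inner-pair⇒D3Connected {p} {q} {suc d} inner-p@(_ , v , _ , _ , p-v , _) inner-q@(deg-q , _) dpq d≢0
    with neighbour-off-multiple (≤-trans (n≤1+n 2) deg-q) (Dist-sym dpq)
  ... | z , q-z , e , dz , e≢0 = λ x y → to-p x ◅◅ ≈₃-sym (to-p y)
    where
    v≈₃p : v ≈₃ p
    v≈₃p = ≈₃-sym (D3-reach-nonmultiple inner-p p-v e dz e≢0) ◅◅
           ≈₃-sym (D3-reach-nonmultiple inner-q q-z (suc d) dpq d≢0)

    to-p : ∀ x → x ≈₃ p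
    to-p x with distance x p
    ... | e′ , dx with e′ % 3 ≟ 0
    ...   | yes e′≡0 = D3-reach-multiple e′ dx e′≡0
    ...   | no e′≢0 = D3-reach-nonmultiple inner-p p-v e′ dx e′≢0 ◅◅ v≈₃p

  InnerNodeOffMultiple : Fin n → Set
  InnerNodeOffMultiple r = ∃ λ m → InnerNode G m × ∃ λ e → Dist G m r e × e % 3 ≢ 0

  module RootedAt (r : Fin n) (deg-r : 2 ≤ deg G r) where

    parent-deg≥2 : ∀ {m u j} → Dist G m r (suc j) → Adj G m u → Dist G u r j → 2 ≤ deg G u
    parent-deg≥2 {j = zero} _ _ du rewrite Dist0⇒≡ du = deg-r
    parent-deg≥2 {j = suc j} dm m-u du with Dist-step du
    ... | w , u-w , dw =
      two-neighbours⇒deg≥2 (Adj-sym m-u) u-w (≢-sym (level-<⇒≢ r dw dm (m<n+m j z<s)))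

    valley⇒inner : ∀ {m s t j} → Dist G m r (suc j) → Adj G m s → Adj G m t → s ≢ t →
      Dist G s r (suc (suc j)) → Dist G t r (suc (suc j)) → 2 ≤ deg G t → InnerNode G m
    valley⇒inner {s = s} {t} dm m-s m-t s≢t ds dt deg-t with Dist-step dm
    ... | u , m-u , du =
      Unique-neighbours⇒length≤deg ((s≢t ∷ s≢u ∷ []) ∷ (t≢u ∷ []) ∷ [] ∷ []) (m-s ∷ m-t ∷ m-u ∷ []) ,
      t , u , t≢u , m-t , m-u , deg-t , parent-deg≥2 dm m-u du
      where
      s≢u : s ≢ u
      s≢u = ≢-sym (level-<⇒≢ r du ds (m<n+m _ z<s))

      t≢u : t ≢ u
      t≢u = ≢-sym (level-<⇒≢ r du dt (m<n+m _ z<s))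

    valley⇒witness : ∀ i {b m s t} → i % 3 ≢ 0 → (i + b) % 3 ≡ 0 →
      Dist G m r b → Adj G m s → Adj G m t → s ≢ t → Dist G s r (suc b) → Dist G t r (suc b) →
      2 ≤ deg G t → InnerNodeOffMultiple r
    valley⇒witness i {zero} i≢0 i≡0 _ _ _ _ _ _ _ = contradiction (%≡0-cancelʳ-+ i 0 3 i≡0 refl) i≢0
    valley⇒witness i {suc j} {m} i≢0 i+b≡0 dm m-s m-t s≢t ds dt deg-t =
      m , valley⇒inner dm m-s m-t s≢t ds dt deg-t , suc j , dm , i≢0 ∘ %≡0-cancelʳ-+ i (suc j) 3 i+b≡0

    residue-change⇒witness : ∀ {y w a e} → D3Adj G y w → Dist G y r a → a % 3 ≡ 0 →
      Dist G w r e → e % 3 ≢ 0 → InnerNodeOffMultiple r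
    residue-change⇒witness y~w dy a≡0 dw e≢0 with D3Adj⇒path y~w
    ... | m₁ , m₂ , y-m₁ , m₁-m₂ , m₂-w , y≢m₂ , m₁≢w = turn (proj₂ (distance m₁ r)) (proj₂ (distance m₂ r))
      where
      -- Straight runs keep the residue and peaks contradict ¬two-parents; only valleys remain.
      turn : ∀ {b c} → Dist G m₁ r b → Dist G m₂ r c → InnerNodeOffMultiple r
      turn dm₁ dm₂
        with adjacent-levels r y-m₁ dy dm₁ | adjacent-levels r m₁-m₂ dm₁ dm₂ | adjacent-levels r m₂-w dm₂ dw
      ... | inj₁ refl | inj₁ refl | inj₁ refl = contradiction a≡0 e≢0
      ... | inj₂ refl | inj₂ refl | inj₂ refl = contradiction a≡0 e≢0
      ... | _ | inj₁ refl | inj₂ refl = ⊥-elim (¬two-parents r dm₂ (Adj-sym m₁-m₂) m₂-w m₁≢w dm₁ dw)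
      ... | inj₁ refl | inj₂ refl | _ = ⊥-elim (¬two-parents r dm₁ (Adj-sym y-m₁) m₁-m₂ y≢m₂ dy dm₂)
      ... | inj₂ refl | inj₁ refl | inj₁ refl =
        valley⇒witness 1 (λ ()) a≡0 dm₁ (Adj-sym y-m₁) m₁-m₂ y≢m₂ dy dm₂
          (two-neighbours⇒deg≥2 (Adj-sym m₁-m₂) m₂-w m₁≢w)
      ... | inj₂ refl | inj₂ refl | inj₁ refl =
        valley⇒witness 2 (λ ()) a≡0 dm₂ m₂-w (Adj-sym m₁-m₂) (≢-sym m₁≢w) dw dm₁
          (two-neighbours⇒deg≥2 (Adj-sym y-m₁) m₁-m₂ y≢m₂)

    D3-walk⇒witness : ∀ {y x a e} → y ≈₃ x → Dist G y r a → a % 3 ≡ 0 →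
      Dist G x r e → e % 3 ≢ 0 → InnerNodeOffMultiple r
    D3-walk⇒witness ε dy a≡0 dx e≢0 = contradiction (subst (λ d → d % 3 ≡ 0) (Dist-unique dy dx) a≡0) e≢0
    D3-walk⇒witness (_◅_ {j = w} y~w w≈₃x) dy a≡0 dx e≢0 with distance w r
    ... | c , dw with c % 3 ≟ 0
    ...   | yes c≡0 = D3-walk⇒witness w≈₃x dw c≡0 dx e≢0
    ...   | no c≢0 = residue-change⇒witness y~w dy a≡0 dw c≢0

    D3Connected⇒witness : D3Connected G → InnerNodeOffMultiple r
    D3Connected⇒witness d3c with neighbour-avoiding [] (≤-trans (n≤1+n 1) deg-r)
    ... | x , r-x , [] = D3-walk⇒witness (d3c r x) Dist-refl refl (Adj⇒Dist1 (Adj-sym r-x)) λ ()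

  D3Connected⇒inner-pair : ∀ y w → y ≢ w → D3Connected G →
    ∃ λ u → ∃ λ v → ∃ λ d → InnerNode G u × InnerNode G v × Dist G u v d × d % 3 ≢ 0
  D3Connected⇒inner-pair y w y≢w d3c with d3c y w
  ... | ε = contradiction refl y≢w
  ... | y~x ◅ _ with D3Adj⇒path y~x
  ...   | m , _ , y-m , m-m₂ , _ , y≢m₂ , _
    with RootedAt.D3Connected⇒witness m (two-neighbours⇒deg≥2 (Adj-sym y-m) m-m₂ y≢m₂) d3c
  ...   | u , inner-u , _
    with RootedAt.D3Connected⇒witness u (≤-trans (n≤1+n 2) (proj₁ inner-u)) d3c
  ...   | v , inner-v , d , dvu , d≢0 = v , u , d , inner-v , inner-u , dvu , d≢0

theorem2p7 : ∀ {n} (G : Graph n) → 2 ≤ n → IsTree G →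
    (D3Connected G ⇔
      (∃[ u ] ∃[ v ] ∃[ d ] ∃[ k ]
        (InnerNode G u × InnerNode G v × Dist G u v d ×
          (d ≡ 3 * k + 1 ⊎ d ≡ 3 * k + 2))))
theorem2p7 G (s≤s (s≤s _)) (connected , acyclic) = mk⇔
  (λ d3c →
    let u , v , d , inner-u , inner-v , duv , d≢0 = D3Connected⇒inner-pair zero (suc zero) (λ ()) d3c
        k , d≡3k+i = %3≢0⇒≡3k+1⊎≡3k+2 d d≢0
    in u , v , d , k , inner-u , inner-v , duv , d≡3k+i)
  (λ (u , v , d , k , inner-u , inner-v , duv , d≡3k+i) →
    inner-pair⇒D3Connected inner-u inner-v duv (≡3k+1⊎≡3k+2⇒%3≢0 k d≡3k+i))
  where open Tree G connected acyclic
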